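{- Let $p\ge1$, $s,t\ge0$, $a_1,\dots,a_p,b_1,\dots,b_p\ge1$ be integers; for an integer $z$ write $z=2p\,\bar z+\hat z$ with $0\le\hat z<2p$. Suppose: (1) for each $j\in\{0,\dots,p-1\}$, at most $j$ of the $\hat a_i$ satisfy $\hat a_i\le j$ and at most $j$ satisfy $\hat a_i\ge2p-j$; (2) for each $j\in\{0,\dots,p-1\}$, at most $j$ of the $\hat b_i$ satisfy $\hat b_i\le j$ and at most $j$ satisfy $\hat b_i\ge2p-j$; (3) there is an integer $d$ with either $-s+\sum_i\bar a_i=2pd$ and $-t+\sum_i\bar b_i=-2pd-p$, or $-s+\sum_i\bar a_i=-2pd-p$ and $-t+\sum_i\bar b_i=2pd$. Let $c=\max\{2p+2s,2p+2t,a_1,\dots,a_p,b_1,\dots,b_p\}$ and define initial conditions $H(v)=\lceil v/2p\rceil$ for $1\le v\le c$. Then the recursion $H(n)=H\big(n-s-\sum_{i=1}^pH(n-a_i)\big)+H\big(n-t-\sum_{i=1}^pH(n-b_i)\big)$ for $n>c$ generates a well-defined solution, and $\lceil n/2p\rceil$ is this unique solution sequence. -}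

module Defs where

open import Data.Nat as ℕ using (ℕ; zero; suc; NonZero; _⊔_)
open import Data.Nat.DivMod as ℕD using ()
open import Data.Nat.Properties using (m*n≢0)
open import Data.Integer as ℤ using (ℤ; +_; -_)
open import Data.Integer.DivMod using (_/ℕ_)
open import Data.Fin using (Fin)
open import Data.List using (length; filter)
open import Data.List.Base using (allFin)
open import Relation.Unary using (Pred; Decidable)
open import Level using (0ℓ)

twoP : ℕ → ℕ
twoP p = 2 ℕ.* p

twoP-nonZero : ∀ p → .{{NonZero p}} → NonZero (twoP p)
twoP-nonZero p = m*n≢0 2 p

hat : (p : ℕ) → .{{NonZero p}} → ℕ → ℕ
hat p z = ℕD._%_ z (twoP p) {{twoP-nonZero p}}

bar : (p : ℕ) → .{{NonZero p}} → ℕ → ℕ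
bar p z = ℕD._/_ z (twoP p) {{twoP-nonZero p}}

ceilDiv : (p : ℕ) → .{{NonZero p}} → ℤ → ℤ
ceilDiv p v = - (_/ℕ_ (- v) (twoP p) {{twoP-nonZero p}})

count : ∀ {p} {P : Pred (Fin p) 0ℓ} → Decidable P → ℕ
count {p} P? = length (filter P? (allFin p))

sumℤ : ∀ {p} → (Fin p → ℤ) → ℤ
sumℤ {zero}  f = + 0
sumℤ {suc p} f = f Data.Fin.zero ℤ.+ sumℤ {p} (λ i → f (Data.Fin.suc i))

maxFin : ∀ {p} → (Fin p → ℕ) → ℕ
maxFin {zero}  f = 0
maxFin {suc p} f = f Data.Fin.zero ⊔ maxFin {p} (λ i → f (Data.Fin.suc i))

cConst : (p s t : ℕ) → (a b : Fin p → ℕ) → ℕ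
cConst p s t a b = (twoP p ℕ.+ 2 ℕ.* s) ⊔ (twoP p ℕ.+ 2 ℕ.* t) ⊔ maxFin a ⊔ maxFin b

HatCondition : (p : ℕ) → .{{NonZero p}} → (Fin p → ℕ) → Set
HatCondition p x =
  ∀ (j : ℕ) → j ℕ.< p →
    (count (λ i → hat p (x i) ℕ.≤? j) ℕ.≤ j) Data.Product.×
    (count (λ i → twoP p ℕ.∸ j ℕ.≤? hat p (x i)) ℕ.≤ j)
  where import Data.Product

recArg : (p : ℕ) → (s : ℕ) → (a : Fin p → ℕ) → (H : ℤ → ℤ) → ℤ → ℤ
recArg p s a H n = n ℤ.- + s ℤ.- sumℤ (λ i → H (n ℤ.- + a i))

module Submission where

-- Write m = 2p and n = m·N - u with N = ⌈n/m⌉, 0 ≤ u < m.  Each look-back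
-- has ⌈(n - a)/m⌉ = N - bar a - [hat a + u ≥ m], so an argument equals
-- p·N - u + K + (Σ bar a_i - s), where K counts the "carries" hat a_i + u ≥ m.
-- The hat condition pins K to u - p < K ≤ u, i.e. u - K = w ∈ [0, p), and the
-- balance condition makes the two arguments p·N - w + 2pd and
-- p·N - w' - 2pd - p; their ceilings are ⌈N/2⌉ + d and ⌈(N-1)/2⌉ - d, which
-- add up to N.  Uniqueness is strong induction on n.

open import Defs
open import Data.Nat as ℕ using (ℕ; NonZero; zero; suc)
import Data.Nat.Properties as ℕP
import Data.Nat.DivMod as ℕD
open import Data.Integer as ℤ using (ℤ; +_; -_; -[1+_]; _+_; _-_; _*_)
import Data.Integer.Properties as ℤP
open import Data.Integer.DivMod using (_/ℕ_; _%ℕ_; n%ℕd<d; a≡a%ℕn+[a/ℕn]*n)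
open import Data.Integer.Tactic.RingSolver using (solve; solve-∀)
open import Data.Fin as Fin using (Fin)
open import Data.List using ([]; _∷_; length; filter; tabulate)
import Data.List.Properties as ListP
open import Data.Product using (_×_; _,_; proj₁; proj₂; ∃-syntax)
open import Data.Sum using (_⊎_; inj₁; inj₂)
open import Relation.Nullary using (¬_; Dec; yes; no; contradiction)
open import Relation.Unary using (Pred; Decidable)
open import Relation.Binary.PropositionalEquality
open import Level using (0ℓ)

⌈_/_⌉ : ℤ → (m : ℕ) → .{{NonZero m}} → ℤ
⌈ v / m ⌉ = - ((- v) /ℕ m)

-- How far v falls short of the next multiple of m: m·⌈v/m⌉ - v.
gap : ℤ → (m : ℕ) → .{{NonZero m}} → ℕ
gap v m = (- v) %ℕ m

gap<m : ∀ v m .{{_ : NonZero m}} → gap v m ℕ.< m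
gap<m v m = n%ℕd<d (- v) m

ceil-spec : ∀ v m .{{_ : NonZero m}} → v ≡ + m * ⌈ v / m ⌉ - + gap v m
ceil-spec v m = begin
  v                                 ≡⟨ sym (ℤP.neg-involutive v) ⟩
  - (- v)                           ≡⟨ cong -_ (a≡a%ℕn+[a/ℕn]*n (- v) m) ⟩
  - (+ gap v m + (- v) /ℕ m * + m)  ≡⟨ negate (+ gap v m) ((- v) /ℕ m) (+ m) ⟩
  + m * ⌈ v / m ⌉ - + gap v m       ∎
  where
  open ≡-Reasoning
  negate : ∀ r q m → - (r + q * m) ≡ m * (- q) - r
  negate = solve-∀

sub-add-cancel : ∀ x r → (x - r) + r ≡ x
sub-add-cancel = solve-∀

-- Representations m·N - u with 0 ≤ u < m are ordered by N: the gap cannot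
-- make up for a whole multiple of m.
representation-≤ : ∀ {m} N C (u r : ℕ) → u ℕ.< m → + m * N - + u ≡ + m * C - + r → N ℤ.≤ C
representation-≤ {m} N C u r u<m eq = ℤP.≤-trans (ℤP.i<j⇒i≤pred[j] N<C+1) (ℤP.≤-reflexive (pred-suc C))
  where
  open ℤP.≤-Reasoning
  pred-suc : ∀ C → - + 1 + (C + + 1) ≡ C
  pred-suc = solve-∀
  add-m : ∀ m C → m * C + m ≡ m * (C + + 1)
  add-m = solve-∀
  mN<m[C+1] : + m * N ℤ.< + m * (C + + 1)
  mN<m[C+1] = begin-strict
    + m * N             ≡⟨ sym (sub-add-cancel (+ m * N) (+ u)) ⟩
    (+ m * N - + u) + + u ≡⟨ cong (_+ + u) eq ⟩
    (+ m * C - + r) + + u ≤⟨ ℤP.+-monoˡ-≤ (+ u) (ℤP.i-j≤i (+ m * C) (+ r)) ⟩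
    + m * C + + u       <⟨ ℤP.+-monoʳ-< (+ m * C) (ℤ.+<+ u<m) ⟩
    + m * C + + m       ≡⟨ add-m (+ m) C ⟩
    + m * (C + + 1)     ∎
  N<C+1 : N ℤ.< C + + 1
  N<C+1 = ℤP.*-cancelˡ-<-nonNeg (+ m) mN<m[C+1]

ceil-unique : ∀ m .{{_ : NonZero m}} N u → u ℕ.< m → ⌈ (+ m * N - + u) / m ⌉ ≡ N
ceil-unique m N u u<m = ℤP.≤-antisym
  (representation-≤ C N (gap v m) u (gap<m v m) (sym v≡))
  (representation-≤ N C u (gap v m) u<m v≡)
  where
  v C : ℤ
  v = + m * N - + u
  C = ⌈ v / m ⌉
  v≡ : v ≡ + m * C - + gap v m
  v≡ = ceil-spec v m

ceil-shift : ∀ v m .{{_ : NonZero m}} k → ⌈ (v + + m * k) / m ⌉ ≡ ⌈ v / m ⌉ + k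
ceil-shift v m k = trans (cong ⌈_/ m ⌉ shifted) (ceil-unique m (⌈ v / m ⌉ + k) (gap v m) (gap<m v m))
  where
  regroup : ∀ m C r k → (m * C - r) + m * k ≡ m * (C + k) - r
  regroup = solve-∀
  shifted : v + + m * k ≡ + m * (⌈ v / m ⌉ + k) - + gap v m
  shifted = trans (cong (λ w → w + + m * k) (ceil-spec v m))
                  (regroup (+ m) ⌈ v / m ⌉ (+ gap v m) k)

ceil-pos : ∀ v m .{{_ : NonZero m}} → + 1 ℤ.≤ v → + 1 ℤ.≤ ⌈ v / m ⌉
ceil-pos v m 1≤v = ℤP.i<j⇒suc[i]≤j (ℤP.*-cancelˡ-<-nonNeg (+ m) m0<mC)
  where
  open ℤP.≤-Reasoning
  C : ℤ
  C = ⌈ v / m ⌉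
  m0<mC : + m * + 0 ℤ.< + m * C
  m0<mC = begin-strict
    + m * + 0            ≡⟨ ℤP.*-zeroʳ (+ m) ⟩
    + 0                  <⟨ ℤP.suc[i]≤j⇒i<j 1≤v ⟩
    v                    ≤⟨ ℤP.i≤i+j v (+ gap v m) ⟩
    v + + gap v m        ≡⟨ cong (_+ + gap v m) (ceil-spec v m) ⟩
    (+ m * C - + gap v m) + + gap v m ≡⟨ sub-add-cancel (+ m * C) (+ gap v m) ⟩
    + m * C              ∎

indicator : ∀ {P : Set} → Dec P → ℤ
indicator (yes _) = + 1
indicator (no _)  = + 0

ceil-carry : ∀ m .{{_ : NonZero m}} N (u h : ℕ) → u ℕ.< m → h ℕ.< m →
  ⌈ (+ m * N - + (u ℕ.+ h)) / m ⌉ ≡ N - indicator (m ℕ.∸ u ℕ.≤? h)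
ceil-carry m N u h u<m h<m with m ℕ.∸ u ℕ.≤? h
... | no m∸u≰h = trans (ceil-unique m N (u ℕ.+ h) u+h<m) (sym (ℤP.+-identityʳ N))
  where
  u+h<m : u ℕ.+ h ℕ.< m
  u+h<m = subst₂ ℕ._<_ (ℕP.+-comm h u) (ℕP.m∸n+n≡m (ℕP.<⇒≤ u<m))
                (ℕP.+-monoˡ-< u (ℕP.≰⇒> m∸u≰h))
... | yes m∸u≤h = trans (cong ⌈_/ m ⌉ carried) (ceil-unique m (N - + 1) w w<m)
  where
  m≤u+h : m ℕ.≤ u ℕ.+ h
  m≤u+h = subst₂ ℕ._≤_ (ℕP.m∸n+n≡m (ℕP.<⇒≤ u<m)) (ℕP.+-comm h u) (ℕP.+-monoˡ-≤ u m∸u≤h)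
  w : ℕ
  w = u ℕ.+ h ℕ.∸ m
  u+h≡m+w : u ℕ.+ h ≡ m ℕ.+ w
  u+h≡m+w = sym (ℕP.m+[n∸m]≡n m≤u+h)
  w<m : w ℕ.< m
  w<m = ℕP.+-cancelˡ-< m w m (subst (ℕ._< m ℕ.+ m) u+h≡m+w (ℕP.+-mono-< u<m h<m))
  borrow : ∀ m N w → m * N - (m + w) ≡ m * (N - + 1) - w
  borrow = solve-∀
  carried : + m * N - + (u ℕ.+ h) ≡ + m * (N - + 1) - + w
  carried = trans (cong (λ k → + m * N - + k) u+h≡m+w) (borrow (+ m) N (+ w))

ceil-halves : ∀ M → ⌈ M / 2 ⌉ + ⌈ (M - + 1) / 2 ⌉ ≡ M
ceil-halves M = subst (λ M → ⌈ M / 2 ⌉ + ⌈ (M - + 1) / 2 ⌉ ≡ M) (sym (ceil-spec M 2))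
                      (halves ⌈ M / 2 ⌉ (gap M 2) (gap<m M 2))
  where
  even-pred : ∀ C → + 2 * C - + 0 - + 1 ≡ + 2 * C - + 1
  even-pred = solve-∀
  even-sum : ∀ C → C + C ≡ + 2 * C - + 0
  even-sum = solve-∀
  odd-pred : ∀ C → + 2 * C - + 1 - + 1 ≡ + 2 * (C - + 1) - + 0
  odd-pred = solve-∀
  odd-sum : ∀ C → C + (C - + 1) ≡ + 2 * C - + 1
  odd-sum = solve-∀
  halves : ∀ C r → r ℕ.< 2 →
    ⌈ (+ 2 * C - + r) / 2 ⌉ + ⌈ (+ 2 * C - + r - + 1) / 2 ⌉ ≡ + 2 * C - + r
  halves C 0 _ = begin
    ⌈ (+ 2 * C - + 0) / 2 ⌉ + ⌈ (+ 2 * C - + 0 - + 1) / 2 ⌉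
      ≡⟨ cong₂ _+_ (ceil-unique 2 C 0 (ℕ.s≤s ℕ.z≤n))
                   (trans (cong ⌈_/ 2 ⌉ (even-pred C)) (ceil-unique 2 C 1 ℕP.≤-refl)) ⟩
    C + C ≡⟨ even-sum C ⟩
    + 2 * C - + 0 ∎
    where open ≡-Reasoning
  halves C 1 _ = begin
    ⌈ (+ 2 * C - + 1) / 2 ⌉ + ⌈ (+ 2 * C - + 1 - + 1) / 2 ⌉
      ≡⟨ cong₂ _+_ (ceil-unique 2 C 1 ℕP.≤-refl)
                   (trans (cong ⌈_/ 2 ⌉ (odd-pred C)) (ceil-unique 2 (C - + 1) 0 (ℕ.s≤s ℕ.z≤n))) ⟩
    C + (C - + 1) ≡⟨ odd-sum C ⟩
    + 2 * C - + 1 ∎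
    where open ≡-Reasoning
  halves C (suc (suc _)) (ℕ.s≤s (ℕ.s≤s ()))

sumℤ-cong : ∀ {p} {f g : Fin p → ℤ} → (∀ i → f i ≡ g i) → sumℤ f ≡ sumℤ g
sumℤ-cong {zero}  f≡g = refl
sumℤ-cong {suc p} f≡g = cong₂ _+_ (f≡g Fin.zero) (sumℤ-cong (λ i → f≡g (Fin.suc i)))

sumℤ-mono : ∀ {p} {f g : Fin p → ℤ} → (∀ i → f i ℤ.≤ g i) → sumℤ f ℤ.≤ sumℤ g
sumℤ-mono {zero}  f≤g = ℤP.≤-refl
sumℤ-mono {suc p} f≤g = ℤP.+-mono-≤ (f≤g Fin.zero) (sumℤ-mono (λ i → f≤g (Fin.suc i)))

sumℤ-const : ∀ {p} c → sumℤ {p} (λ _ → c) ≡ + p * c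
sumℤ-const {zero}  c = sym (ℤP.*-zeroˡ c)
sumℤ-const {suc p} c = begin
  c + sumℤ {p} (λ _ → c)  ≡⟨ cong (λ k → c + k) (sumℤ-const {p} c) ⟩
  c + + p * c             ≡⟨ add-one (+ p) c ⟩
  + suc p * c             ∎
  where
  open ≡-Reasoning
  add-one : ∀ p c → c + p * c ≡ (+ 1 + p) * c
  add-one = solve-∀

sumℤ-affine : ∀ {p} c (x y : Fin p → ℤ) →
  sumℤ (λ i → c - x i - y i) ≡ + p * c - sumℤ x - sumℤ y
sumℤ-affine {zero}  c x y = solve (c ∷ [])
sumℤ-affine {suc p} c x y = begin
  (c - x Fin.zero - y Fin.zero) + sumℤ (λ i → c - x (Fin.suc i) - y (Fin.suc i))
    ≡⟨ cong (λ k → (c - x Fin.zero - y Fin.zero) + k) (sumℤ-affine c (λ i → x (Fin.suc i)) (λ i → y (Fin.suc i))) ⟩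
  (c - x Fin.zero - y Fin.zero) + (+ p * c - sumℤ (λ i → x (Fin.suc i)) - sumℤ (λ i → y (Fin.suc i)))
    ≡⟨ regroup c (x Fin.zero) (y Fin.zero) (+ p) (sumℤ (λ i → x (Fin.suc i))) (sumℤ (λ i → y (Fin.suc i))) ⟩
  + suc p * c - sumℤ x - sumℤ y ∎
  where
  open ≡-Reasoning
  regroup : ∀ c x₀ y₀ p X Y → (c - x₀ - y₀) + (p * c - X - Y) ≡ (+ 1 + p) * c - (x₀ + X) - (y₀ + Y)
  regroup = solve-∀

maxFin-≤ : ∀ {p} (f : Fin p → ℕ) i → f i ℕ.≤ maxFin f
maxFin-≤ f Fin.zero    = ℕP.m≤m⊔n _ _
maxFin-≤ f (Fin.suc i) = ℕP.≤-trans (maxFin-≤ (λ j → f (Fin.suc j)) i) (ℕP.m≤n⊔m _ _)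

count-as-sum : ∀ {p} {P : Pred (Fin p) 0ℓ} (P? : Decidable P) →
  + count P? ≡ sumℤ (λ i → indicator (P? i))
count-as-sum P? = tabulated P? (λ i → i)
  where
  tabulated : ∀ {q} {P : Pred (Fin q) 0ℓ} (P? : Decidable P) {p} (g : Fin p → Fin q) →
    + length (filter P? (tabulate g)) ≡ sumℤ (λ i → indicator (P? (g i)))
  tabulated P? {zero}  g = refl
  tabulated P? {suc p} g with P? (g Fin.zero)
  ... | yes _ = cong (λ k → + 1 + k) (tabulated P? (λ i → g (Fin.suc i)))
  ... | no _  = trans (tabulated P? (λ i → g (Fin.suc i))) (sym (ℤP.+-identityˡ _))

count≤ : ∀ {p} {P : Pred (Fin p) 0ℓ} (P? : Decidable P) → count P? ℕ.≤ p
count≤ {p} P? = ℕP.≤-trans (ListP.length-filter P? (Data.List.allFin p))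
                           (ℕP.≤-reflexive (ListP.length-tabulate (λ i → i)))

count-complementary : ∀ {p} {P Q : Pred (Fin p) 0ℓ} (P? : Decidable P) (Q? : Decidable Q) →
  (∀ i → P i → ¬ Q i) → (∀ i → ¬ P i → Q i) → count P? ℕ.+ count Q? ≡ p
count-complementary {p} P? Q? disjoint cover =
  trans (split (Data.List.allFin p)) (ListP.length-tabulate (λ i → i))
  where
  split : ∀ xs → length (filter P? xs) ℕ.+ length (filter Q? xs) ≡ length xs
  split []       = refl
  split (x ∷ xs) with P? x | Q? x
  ... | yes px | yes qx = contradiction qx (disjoint x px)
  ... | yes _  | no _   = cong suc (split xs)
  ... | no _   | yes _  = trans (ℕP.+-suc _ _) (cong suc (split xs))
  ... | no ¬px | no ¬qx = contradiction (cover x ¬px) ¬qx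

sub-pos-< : ∀ i {j} → + 0 ℤ.< j → i - j ℤ.< i
sub-pos-< i 0<j = subst (i - _ ℤ.<_) (ℤP.+-identityʳ i) (ℤP.+-monoʳ-< i (ℤP.neg-mono-< 0<j))

lookback-range : ∀ n (a : ℕ) → 1 ℕ.≤ a → + a ℤ.< n → + 1 ℤ.≤ n - + a × n - + a ℤ.< n
lookback-range n a 1≤a a<n = 1≤n-a , sub-pos-< n (ℤ.+<+ 1≤a)
  where
  open ℤP.≤-Reasoning
  cancel : ∀ a → + 1 ≡ (+ 1 + a) - a
  cancel = solve-∀
  1≤n-a : + 1 ℤ.≤ n - + a
  1≤n-a = begin
    + 1              ≡⟨ cancel (+ a) ⟩
    (+ 1 + + a) - + a ≤⟨ ℤP.+-monoˡ-≤ (- + a) (ℤP.i<j⇒suc[i]≤j a<n) ⟩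
    n - + a          ∎

module Modulus (p : ℕ) .{{_ : NonZero p}} where

  m : ℕ
  m = twoP p

  instance
    m-nonZero : NonZero m
    m-nonZero = twoP-nonZero p

  m≡p+p : m ≡ p ℕ.+ p
  m≡p+p = cong (p ℕ.+_) (ℕP.+-identityʳ p)

  ceil-scaled-half : ∀ M (w : ℕ) → w ℕ.< p → ⌈ (+ p * M - + w) / m ⌉ ≡ ⌈ M / 2 ⌉
  ceil-scaled-half M w w<p = trans (cong ⌈_/ m ⌉ scaled) (ceil-unique m C (p ℕ.* r ℕ.+ w) pr+w<m)
    where
    C : ℤ
    C = ⌈ M / 2 ⌉
    r : ℕ
    r = gap M 2
    pr+w<m : p ℕ.* r ℕ.+ w ℕ.< m
    pr+w<m = subst (p ℕ.* r ℕ.+ w ℕ.<_) (sym m≡p+p)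
               (ℕP.+-mono-≤-< (ℕP.≤-trans (ℕP.*-monoʳ-≤ p (ℕP.<⇒≤pred (gap<m M 2)))
                                          (ℕP.≤-reflexive (ℕP.*-identityʳ p))) w<p)
    rescale : ∀ p C r w → p * (+ 2 * C - r) - w ≡ (+ 2 * p) * C - (p * r + w)
    rescale = solve-∀
    scaled : + p * M - + w ≡ + m * C - + (p ℕ.* r ℕ.+ w)
    scaled = begin
      + p * M - + w                       ≡⟨ cong (λ M → + p * M - + w) (ceil-spec M 2) ⟩
      + p * (+ 2 * C - + r) - + w          ≡⟨ rescale (+ p) C (+ r) (+ w) ⟩
      (+ 2 * + p) * C - (+ p * + r + + w)  ≡⟨ cong₂ (λ m k → m * C - k) (sym (ℤP.pos-* 2 p))
                                                   (cong (_+ + w) (sym (ℤP.pos-* p r))) ⟩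
      + m * C - + (p ℕ.* r ℕ.+ w)          ∎
      where open ≡-Reasoning

  -- The arithmetic heart of the corollary: for wa, wb < p and any d,
  -- ⌈(pN - wa + 2pd)/2p⌉ + ⌈(pN - wb - 2pd - p)/2p⌉ = ⌈N/2⌉ + ⌈(N-1)/2⌉ = N.
  ceil-pair : ∀ N d (wa wb : ℕ) → wa ℕ.< p → wb ℕ.< p →
    ⌈ (+ p * N - + wa + + m * d) / m ⌉ + ⌈ (+ p * N - + wb + (- (+ m * d) - + p)) / m ⌉ ≡ N
  ceil-pair N d wa wb wa<p wb<p = begin
    ⌈ (+ p * N - + wa + + m * d) / m ⌉ + ⌈ (+ p * N - + wb + (- (+ m * d) - + p)) / m ⌉
      ≡⟨ cong (λ v → ⌈ (+ p * N - + wa + + m * d) / m ⌉ + ⌈ v / m ⌉)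
              (move-p (+ p) N (+ wb) (+ m) d) ⟩
    ⌈ (+ p * N - + wa + + m * d) / m ⌉ + ⌈ (+ p * (N - + 1) - + wb + + m * (- d)) / m ⌉
      ≡⟨ cong₂ _+_ (ceil-shift (+ p * N - + wa) m d) (ceil-shift (+ p * (N - + 1) - + wb) m (- d)) ⟩
    (⌈ (+ p * N - + wa) / m ⌉ + d) + (⌈ (+ p * (N - + 1) - + wb) / m ⌉ + - d)
      ≡⟨ cong₂ (λ x y → (x + d) + (y + - d)) (ceil-scaled-half N wa wa<p)
                                              (ceil-scaled-half (N - + 1) wb wb<p) ⟩
    (⌈ N / 2 ⌉ + d) + (⌈ (N - + 1) / 2 ⌉ + - d) ≡⟨ cancel-d ⌈ N / 2 ⌉ ⌈ (N - + 1) / 2 ⌉ d ⟩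
    ⌈ N / 2 ⌉ + ⌈ (N - + 1) / 2 ⌉               ≡⟨ ceil-halves N ⟩
    N ∎
    where
    open ≡-Reasoning
    move-p : ∀ p N w m d → p * N - w + (- (m * d) - p) ≡ p * (N - + 1) - w + m * (- d)
    move-p = solve-∀
    cancel-d : ∀ x y d → (x + d) + (y + - d) ≡ x + y
    cancel-d = solve-∀

  carries : (Fin p → ℕ) → ℕ → ℕ
  carries x u = count (λ i → m ℕ.∸ u ℕ.≤? hat p (x i))

  -- For u < p this is the second half
  -- of the condition at j = u; for u ≥ p it is the first half at
  -- j = 2p - 1 - u, since the indices without a carry are those with hat ≤ j.
  carries-bounds : ∀ x → HatCondition p x → ∀ u → u ℕ.< m →
    carries x u ℕ.≤ u × u ℕ.< p ℕ.+ carries x u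
  carries-bounds x hat-cond u u<m with u ℕ.<? p
  ... | yes u<p = proj₂ (hat-cond u u<p) , ℕP.<-≤-trans u<p (ℕP.m≤m+n p _)
  ... | no u≮p = ℕP.≤-trans (count≤ _) p≤u , u<p+K
    where
    open ℕP.≤-Reasoning
    K : ℕ
    K = carries x u
    p≤u : p ℕ.≤ u
    p≤u = ℕP.≮⇒≥ u≮p
    j : ℕ
    j = m ℕ.∸ suc u
    1+u+j≡m : suc u ℕ.+ j ≡ m
    1+u+j≡m = ℕP.m+[n∸m]≡n u<m
    j<p : j ℕ.< p
    j<p = ℕP.+-cancelˡ-< p j p (begin-strict
      p ℕ.+ j      <⟨ ℕP.+-monoˡ-< j (ℕ.s≤s p≤u) ⟩
      suc u ℕ.+ j  ≡⟨ trans 1+u+j≡m m≡p+p ⟩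
      p ℕ.+ p      ∎)
    m∸u≡1+j : m ℕ.∸ u ≡ suc j
    m∸u≡1+j = trans (cong (ℕ._∸ u) (trans (sym 1+u+j≡m) (sym (ℕP.+-suc u j)))) (ℕP.m+n∸m≡n u (suc j))
    L : ℕ
    L = count (λ i → hat p (x i) ℕ.≤? j)
    L+K≡p : L ℕ.+ K ≡ p
    L+K≡p = count-complementary _ _
      (λ i h≤j m∸u≤h → ℕP.<-irrefl refl (ℕP.≤-trans (subst (ℕ._≤ hat p (x i)) m∸u≡1+j m∸u≤h) h≤j))
      (λ i h≰j → subst (ℕ._≤ hat p (x i)) (sym m∸u≡1+j) (ℕP.≰⇒> h≰j))
    u<p+K : u ℕ.< p ℕ.+ K
    u<p+K = ℕP.+-cancelʳ-≤ L (suc u) (p ℕ.+ K) (begin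
      suc u ℕ.+ L        ≤⟨ ℕP.+-monoʳ-≤ (suc u) (proj₁ (hat-cond j j<p)) ⟩
      suc u ℕ.+ j        ≡⟨ trans 1+u+j≡m m≡p+p ⟩
      p ℕ.+ p            ≡⟨ cong (p ℕ.+_) (trans (sym L+K≡p) (ℕP.+-comm L K)) ⟩
      p ℕ.+ (K ℕ.+ L)    ≡⟨ sym (ℕP.+-assoc p K L) ⟩
      p ℕ.+ K ℕ.+ L      ∎)

  barSum : (Fin p → ℕ) → ℤ
  barSum x = sumℤ (λ i → + bar p (x i))

  ceil-sub : ∀ n a →
    ⌈ (n - + a) / m ⌉ ≡ ⌈ n / m ⌉ - + bar p a - indicator (m ℕ.∸ gap n m ℕ.≤? hat p a)
  ceil-sub n a = begin
    ⌈ (n - + a) / m ⌉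
      ≡⟨ cong ⌈_/ m ⌉ split ⟩
    ⌈ (+ m * N - + (u ℕ.+ h) + + m * - + B) / m ⌉
      ≡⟨ ceil-shift (+ m * N - + (u ℕ.+ h)) m (- + B) ⟩
    ⌈ (+ m * N - + (u ℕ.+ h)) / m ⌉ + - + B
      ≡⟨ cong (_+ - + B) (ceil-carry m N u h (gap<m n m) (ℕD.m%n<n a m)) ⟩
    N - indicator (m ℕ.∸ u ℕ.≤? h) + - + B
      ≡⟨ swap N (indicator (m ℕ.∸ u ℕ.≤? h)) (+ B) ⟩
    N - + B - indicator (m ℕ.∸ u ℕ.≤? h) ∎
    where
    open ≡-Reasoning
    N : ℤ
    N = ⌈ n / m ⌉
    u h B : ℕ
    u = gap n m
    h = hat p a
    B = bar p a
    swap : ∀ N I B → N - I + - B ≡ N - B - I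
    swap = solve-∀
    regroup : ∀ m N u h B → (m * N - u) - (h + B * m) ≡ m * N - (u + h) + m * - B
    regroup = solve-∀
    split : n - + a ≡ + m * N - + (u ℕ.+ h) + + m * - + B
    split = trans (cong₂ _-_ (ceil-spec n m) (a≡a%ℕn+[a/ℕn]*n (+ a) m))
                  (regroup (+ m) N (+ u) (+ h) (+ B))

  sum-ceil-sub : ∀ n (x : Fin p → ℕ) →
    sumℤ (λ i → ⌈ (n - + x i) / m ⌉) ≡ + p * ⌈ n / m ⌉ - barSum x - + carries x (gap n m)
  sum-ceil-sub n x = begin
    sumℤ (λ i → ⌈ (n - + x i) / m ⌉)
      ≡⟨ sumℤ-cong (λ i → ceil-sub n (x i)) ⟩
    sumℤ (λ i → ⌈ n / m ⌉ - + bar p (x i) - indicator (m ℕ.∸ gap n m ℕ.≤? hat p (x i)))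
      ≡⟨ sumℤ-affine ⌈ n / m ⌉ (λ i → + bar p (x i)) (λ i → indicator (m ℕ.∸ gap n m ℕ.≤? hat p (x i))) ⟩
    + p * ⌈ n / m ⌉ - barSum x - sumℤ (λ i → indicator (m ℕ.∸ gap n m ℕ.≤? hat p (x i)))
      ≡⟨ cong (λ k → + p * ⌈ n / m ⌉ - barSum x - k) (sym (count-as-sum {p} (λ i → m ℕ.∸ gap n m ℕ.≤? hat p (x i)))) ⟩
    + p * ⌈ n / m ⌉ - barSum x - + carries x (gap n m) ∎
    where open ≡-Reasoning

  recArg-ceil : ∀ n s x → recArg p s x (ceilDiv p) n ≡
    (+ p * ⌈ n / m ⌉ - + gap n m - + s) + (barSum x + + carries x (gap n m))
  recArg-ceil n s x = begin
    n - + s - sumℤ (λ i → ⌈ (n - + x i) / m ⌉)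
      ≡⟨ cong₂ (λ v S → v - + s - S) (ceil-spec n m) (sum-ceil-sub n x) ⟩
    (+ m * N - + u) - + s - (+ p * N - barSum x - + K)
      ≡⟨ cong (λ k → (k * N - + u) - + s - (+ p * N - barSum x - + K)) (cong +_ m≡p+p) ⟩
    ((+ p + + p) * N - + u) - + s - (+ p * N - barSum x - + K)
      ≡⟨ regroup (+ p) N (+ u) (+ s) (barSum x) (+ K) ⟩
    (+ p * N - + u - + s) + (barSum x + + K) ∎
    where
    open ≡-Reasoning
    N : ℤ
    N = ⌈ n / m ⌉
    u K : ℕ
    u = gap n m
    K = carries x u
    regroup : ∀ p N u s B K → ((p + p) * N - u) - s - (p * N - B - K) ≡ (p * N - u - s) + (B + K)
    regroup = solve-∀

  -- Under the hat condition the gap minus the carries is some w < p, so the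
  -- recursion argument is p⌈n/m⌉ - w + (Σ bar(x i) - s).
  recArg-ceil-residual : ∀ x → HatCondition p x → ∀ n s →
    ∃[ w ] (w ℕ.< p × recArg p s x (ceilDiv p) n ≡ + p * ⌈ n / m ⌉ - + w + (- + s + barSum x))
  recArg-ceil-residual x hat-cond n s = w , w<p , (begin
    recArg p s x (ceilDiv p) n
      ≡⟨ recArg-ceil n s x ⟩
    (+ p * N - + u - + s) + (barSum x + + K)
      ≡⟨ cong (λ k → (+ p * N - k - + s) + (barSum x + + K)) (cong +_ u≡K+w) ⟩
    (+ p * N - (+ K + + w) - + s) + (barSum x + + K)
      ≡⟨ regroup (+ p) N (+ K) (+ w) (+ s) (barSum x) ⟩
    + p * N - + w + (- + s + barSum x) ∎)
    where
    open ≡-Reasoning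
    N : ℤ
    N = ⌈ n / m ⌉
    u K : ℕ
    u = gap n m
    K = carries x u
    K≤u : K ℕ.≤ u
    K≤u = proj₁ (carries-bounds x hat-cond u (gap<m n m))
    u<p+K : u ℕ.< p ℕ.+ K
    u<p+K = proj₂ (carries-bounds x hat-cond u (gap<m n m))
    w : ℕ
    w = u ℕ.∸ K
    u≡K+w : u ≡ K ℕ.+ w
    u≡K+w = sym (ℕP.m+[n∸m]≡n K≤u)
    w<p : w ℕ.< p
    w<p = subst (w ℕ.<_) (ℕP.m+n∸n≡m p K) (ℕP.∸-monoˡ-< u<p+K K≤u)
    regroup : ∀ p N K w s B → (p * N - (K + w) - s) + (B + K) ≡ p * N - w + (- s + B)
    regroup = solve-∀

  BarBalance : (s t : ℕ) (a b : Fin p → ℕ) → Set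
  BarBalance s t a b = ∃[ d ]
    ((- + s + barSum a ≡ + m * d × - + t + barSum b ≡ - (+ m * d) - + p)
     ⊎ (- + s + barSum a ≡ - (+ m * d) - + p × - + t + barSum b ≡ + m * d))

  ceil-recursion : ∀ s t a b → HatCondition p a → HatCondition p b → BarBalance s t a b →
    ∀ n → ⌈ n / m ⌉ ≡ ⌈ recArg p s a (ceilDiv p) n / m ⌉ + ⌈ recArg p t b (ceilDiv p) n / m ⌉
  ceil-recursion s t a b hat-a hat-b (d , balance) n =
    sym (balanced balance (recArg-ceil-residual a hat-a n s) (recArg-ceil-residual b hat-b n t))
    where
    N : ℤ
    N = ⌈ n / m ⌉
    balanced : ∀ {Xa Xb R₁ R₂ : ℤ} →
      (Xa ≡ + m * d × Xb ≡ - (+ m * d) - + p) ⊎ (Xa ≡ - (+ m * d) - + p × Xb ≡ + m * d) →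
      ∃[ w ] (w ℕ.< p × R₁ ≡ + p * N - + w + Xa) → ∃[ w ] (w ℕ.< p × R₂ ≡ + p * N - + w + Xb) →
      ⌈ R₁ / m ⌉ + ⌈ R₂ / m ⌉ ≡ N
    balanced (inj₁ (refl , refl)) (wa , wa<p , refl) (wb , wb<p , refl) =
      ceil-pair N d wa wb wa<p wb<p
    balanced (inj₂ (refl , refl)) (wa , wa<p , refl) (wb , wb<p , refl) =
      trans (ℤP.+-comm ⌈ (+ p * N - + wa + (- (+ m * d) - + p)) / m ⌉ ⌈ (+ p * N - + wb + + m * d) / m ⌉)
            (ceil-pair N d wb wa wb<p wa<p)

  -- Beyond 2p + 2s and beyond every look-back x i ≥ 1, the recursion
  -- argument of the ceiling sequence lies in [1, n).  The lower bound uses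
  -- 2(p⌈n/m⌉ - u - s) = n - u - 2s > m - u > 0; the upper bound uses that
  -- every ⌈(n - x i)/m⌉ is positive.
  recArg-ceil-range : ∀ n s x → (∀ i → 1 ℕ.≤ x i) → (∀ i → + x i ℤ.< n) →
    + (m ℕ.+ 2 ℕ.* s) ℤ.< n →
    + 1 ℤ.≤ recArg p s x (ceilDiv p) n × recArg p s x (ceilDiv p) n ℤ.< n
  recArg-ceil-range n s x x≥1 x<n m+2s<n = lower , upper
    where
    open ℤP.≤-Reasoning
    u : ℕ
    u = gap n m
    T Σ : ℤ
    T = + p * ⌈ n / m ⌉ - + u - + s
    Σ = sumℤ (λ i → ⌈ (n - + x i) / m ⌉)

    cancel : ∀ k → + 2 * + 1 ≡ (k + + 2) - k
    cancel = solve-∀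
    double : ∀ p N u s → (p + p) * N - u - (u + + 2 * s) ≡ + 2 * (p * N - u - s)
    double = solve-∀
    u+2s+2≤n : + (u ℕ.+ 2 ℕ.* s) + + 2 ℤ.≤ n
    u+2s+2≤n = ℤP.≤-trans (ℤ.+≤+ (ℕP.≤-trans (ℕP.≤-reflexive (ℕP.+-comm (u ℕ.+ 2 ℕ.* s) 2))
                                             (ℕ.s≤s (ℕP.+-monoˡ-≤ (2 ℕ.* s) (gap<m n m)))))
                          (ℤP.i<j⇒suc[i]≤j m+2s<n)
    2≤2T : + 2 * + 1 ℤ.≤ + 2 * T
    2≤2T = begin
      + 2 * + 1                                   ≡⟨ cancel (+ (u ℕ.+ 2 ℕ.* s)) ⟩
      (+ (u ℕ.+ 2 ℕ.* s) + + 2) - + (u ℕ.+ 2 ℕ.* s) ≤⟨ ℤP.+-monoˡ-≤ (- + (u ℕ.+ 2 ℕ.* s)) u+2s+2≤n ⟩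
      n - + (u ℕ.+ 2 ℕ.* s)                       ≡⟨ cong₂ _-_ (ceil-spec n m)
                                                       (cong (λ k → + u + k) (ℤP.pos-* 2 s)) ⟩
      (+ m * ⌈ n / m ⌉ - + u) - (+ u + + 2 * + s)  ≡⟨ cong (λ k → (k * ⌈ n / m ⌉ - + u) - (+ u + + 2 * + s)) (cong +_ m≡p+p) ⟩
      ((+ p + + p) * ⌈ n / m ⌉ - + u) - (+ u + + 2 * + s) ≡⟨ double (+ p) ⌈ n / m ⌉ (+ u) (+ s) ⟩
      + 2 * T                                      ∎
    0≤barSum : + 0 ℤ.≤ barSum x
    0≤barSum = ℤP.≤-trans (ℤP.≤-reflexive (trans (sym (ℤP.*-zeroʳ (+ p))) (sym (sumℤ-const {p} (+ 0)))))
                          (sumℤ-mono {g = λ i → + bar p (x i)} (λ i → ℤ.+≤+ ℕ.z≤n))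
    lower : + 1 ℤ.≤ recArg p s x (ceilDiv p) n
    lower = begin
      + 1                          ≤⟨ ℤP.*-cancelˡ-≤-pos (+ 1) T (+ 2) 2≤2T ⟩
      T                            ≡⟨ sym (ℤP.+-identityʳ T) ⟩
      T + + 0                      ≤⟨ ℤP.+-monoʳ-≤ T (ℤP.+-mono-≤ 0≤barSum (ℤ.+≤+ ℕ.z≤n)) ⟩
      T + (barSum x + + carries x u) ≡⟨ sym (recArg-ceil n s x) ⟩
      recArg p s x (ceilDiv p) n   ∎

    0<Σ : + 0 ℤ.< Σ
    0<Σ = begin-strict
      + 0                     <⟨ ℤ.+<+ (ℕ.>-nonZero⁻¹ p) ⟩
      + p                     ≡⟨ sym (trans (sumℤ-const {p} (+ 1)) (ℤP.*-identityʳ (+ p))) ⟩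
      sumℤ {p} (λ _ → + 1)     ≤⟨ sumℤ-mono (λ i → ceil-pos (n - + x i) m (proj₁ (lookback-range n (x i) (x≥1 i) (x<n i)))) ⟩
      Σ                       ∎
    reorder : ∀ n s S → n - s - S ≡ (n - S) - s
    reorder = solve-∀
    upper : recArg p s x (ceilDiv p) n ℤ.< n
    upper = begin-strict
      n - + s - Σ   ≡⟨ reorder n (+ s) Σ ⟩
      (n - Σ) - + s ≤⟨ ℤP.i-j≤i (n - Σ) (+ s) ⟩
      n - Σ         <⟨ sub-pos-< n 0<Σ ⟩
      n             ∎

recArg-cong : ∀ p s (x : Fin p → ℕ) (H G : ℤ → ℤ) n →
  (∀ i → H (n - + x i) ≡ G (n - + x i)) → recArg p s x H n ≡ recArg p s x G n
recArg-cong p s x H G n H≡G = cong (λ S → n - + s - S) (sumℤ-cong H≡G)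

SolvesAt : (p s t : ℕ) (a b : Fin p → ℕ) (G : ℤ → ℤ) → ℤ → Set
SolvesAt p s t a b G n =
  let R₁ = recArg p s a G n
      R₂ = recArg p t b G n
  in (+ 1 ℤ.≤ R₁) × (R₁ ℤ.< n) × (+ 1 ℤ.≤ R₂) × (R₂ ℤ.< n) × (G n ≡ G R₁ + G R₂)

module Uniqueness {p : ℕ} (s t c : ℕ) (a b : Fin p → ℕ)
  (a≥1 : ∀ i → 1 ℕ.≤ a i) (b≥1 : ∀ i → 1 ℕ.≤ b i)
  (a≤c : ∀ i → a i ℕ.≤ c) (b≤c : ∀ i → b i ℕ.≤ c)
  (G : ℤ → ℤ) (G-solves : ∀ n → + c ℤ.< n → SolvesAt p s t a b G n)
  (H : ℤ → ℤ)
  (initial : ∀ v → + 1 ℤ.≤ v → v ℤ.≤ + c → H v ≡ G v)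
  (recursion : ∀ n → + c ℤ.< n → H n ≡ H (recArg p s a H n) + H (recArg p t b H n)) where

  agree-below : ∀ k n → + 1 ℤ.≤ n → n ℤ.< + k → H n ≡ G n
  agree-below zero    n 1≤n n<0 with ℤP.≤-<-trans 1≤n n<0
  ... | ℤ.+<+ ()
  agree-below (suc k) n 1≤n n<1+k with n ℤ.≤? + c
  ... | yes n≤c = initial n 1≤n n≤c
  ... | no n≰c = step (G-solves n c<n)
    where
    open ≡-Reasoning
    c<n : + c ℤ.< n
    c<n = ℤP.≰⇒> n≰c
    below : ∀ v → + 1 ℤ.≤ v → v ℤ.< n → H v ≡ G v
    below v 1≤v v<n = agree-below k v 1≤v (ℤP.<-≤-trans v<n (ℤP.i<j⇒i≤pred[j] n<1+k))
    same-arg : ∀ s (x : Fin p → ℕ) → (∀ i → 1 ℕ.≤ x i) → (∀ i → x i ℕ.≤ c) →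
      recArg p s x H n ≡ recArg p s x G n
    same-arg s x x≥1 x≤c = recArg-cong p s x H G n (λ i →
      let (1≤n-x , n-x<n) = lookback-range n (x i) (x≥1 i) (ℤP.≤-<-trans (ℤ.+≤+ (x≤c i)) c<n)
      in below (n - + x i) 1≤n-x n-x<n)
    R₁ R₂ : ℤ
    R₁ = recArg p s a G n
    R₂ = recArg p t b G n
    step : SolvesAt p s t a b G n → H n ≡ G n
    step (1≤R₁ , R₁<n , 1≤R₂ , R₂<n , G-rec) = begin
      H n                                         ≡⟨ recursion n c<n ⟩
      H (recArg p s a H n) + H (recArg p t b H n) ≡⟨ cong₂ (λ r r′ → H r + H r′) (same-arg s a a≥1 a≤c)
                                                                                (same-arg t b b≥1 b≤c) ⟩
      H R₁ + H R₂                                 ≡⟨ cong₂ _+_ (below R₁ 1≤R₁ R₁<n) (below R₂ 1≤R₂ R₂<n) ⟩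
      G R₁ + G R₂                                 ≡⟨ sym G-rec ⟩
      G n                                         ∎

  agree : ∀ n → + 1 ℤ.≤ n → H n ≡ G n
  agree (+ n)      1≤n = agree-below (suc n) (+ n) 1≤n (ℤ.+<+ (ℕP.n<1+n n))
  agree -[1+ n ] ()

module _ (p s t : ℕ) (a b : Fin p → ℕ) where

  private
    S T A B : ℕ
    S = twoP p ℕ.+ 2 ℕ.* s
    T = twoP p ℕ.+ 2 ℕ.* t
    A = maxFin a
    B = maxFin b

    below-c : ∀ {k} → k ℕ.≤ S ℕ.⊔ T ℕ.⊔ A → k ℕ.≤ cConst p s t a b
    below-c k≤ = ℕP.≤-trans k≤ (ℕP.m≤m⊔n (S ℕ.⊔ T ℕ.⊔ A) B)

  cConst-s : S ℕ.≤ cConst p s t a b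
  cConst-s = below-c (ℕP.≤-trans (ℕP.m≤m⊔n S T) (ℕP.m≤m⊔n (S ℕ.⊔ T) A))

  cConst-t : T ℕ.≤ cConst p s t a b
  cConst-t = below-c (ℕP.≤-trans (ℕP.m≤n⊔m S T) (ℕP.m≤m⊔n (S ℕ.⊔ T) A))

  cConst-a : ∀ i → a i ℕ.≤ cConst p s t a b
  cConst-a i = below-c (ℕP.≤-trans (maxFin-≤ a i) (ℕP.m≤n⊔m (S ℕ.⊔ T) A))

  cConst-b : ∀ i → b i ℕ.≤ cConst p s t a b
  cConst-b i = ℕP.≤-trans (maxFin-≤ b i) (ℕP.m≤n⊔m (S ℕ.⊔ T ℕ.⊔ A) B)

corollary5p10 :
    (p : ℕ) → .{{_ : NonZero p}} → (s t : ℕ) → (a b : Fin p → ℕ) →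
    (∀ i → 1 ℕ.≤ a i) → (∀ i → 1 ℕ.≤ b i) →
    HatCondition p a →
    HatCondition p b →
    (∃[ d ] ((- (+ s) ℤ.+ sumℤ (λ i → + bar p (a i)) ≡ + twoP p ℤ.* d
               × - (+ t) ℤ.+ sumℤ (λ i → + bar p (b i)) ≡ - (+ twoP p ℤ.* d) ℤ.- + p)
            ⊎ (- (+ s) ℤ.+ sumℤ (λ i → + bar p (a i)) ≡ - (+ twoP p ℤ.* d) ℤ.- + p
               × - (+ t) ℤ.+ sumℤ (λ i → + bar p (b i)) ≡ + twoP p ℤ.* d))) →
    ((∀ (n : ℤ) → + cConst p s t a b ℤ.< n →
        (+ 1 ℤ.≤ recArg p s a (ceilDiv p) n) × (recArg p s a (ceilDiv p) n ℤ.< n)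
        × (+ 1 ℤ.≤ recArg p t b (ceilDiv p) n) × (recArg p t b (ceilDiv p) n ℤ.< n)
        × (ceilDiv p n ≡ ceilDiv p (recArg p s a (ceilDiv p) n) ℤ.+ ceilDiv p (recArg p t b (ceilDiv p) n)))
     × (∀ (H : ℤ → ℤ) →
          (∀ v → + 1 ℤ.≤ v → v ℤ.≤ + cConst p s t a b → H v ≡ ceilDiv p v) →
          (∀ n → + cConst p s t a b ℤ.< n → H n ≡ H (recArg p s a H n) ℤ.+ H (recArg p t b H n)) →
          ∀ n → + 1 ℤ.≤ n → H n ≡ ceilDiv p n))
corollary5p10 p s t a b a≥1 b≥1 hat-a hat-b balance =
  ceil-solves ,
  λ H initial recursion → Uniqueness.agree s t c a b a≥1 b≥1 (cConst-a p s t a b) (cConst-b p s t a b)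
                                           (ceilDiv p) ceil-solves H initial recursion
  where
  open Modulus p
  c : ℕ
  c = cConst p s t a b

  ceil-solves : ∀ n → + c ℤ.< n → SolvesAt p s t a b (ceilDiv p) n
  ceil-solves n c<n =
    let (1≤R₁ , R₁<n) = recArg-ceil-range n s a a≥1 (λ i → beyond (cConst-a p s t a b i)) (beyond (cConst-s p s t a b))
        (1≤R₂ , R₂<n) = recArg-ceil-range n t b b≥1 (λ i → beyond (cConst-b p s t a b i)) (beyond (cConst-t p s t a b))
    in 1≤R₁ , R₁<n , 1≤R₂ , R₂<n , ceil-recursion s t a b hat-a hat-b balance n
    where
    beyond : ∀ {k} → k ℕ.≤ c → + k ℤ.< n
    beyond k≤c = ℤP.≤-<-trans (ℤ.+≤+ k≤c) c<n
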